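{- Let $\mathcal{R}$ be a finite family of closed axis-parallel rectangles in the plane in general position, let $k \geq 0$ be an integer, and let the horizontal lines $\ell_1,\dots,\ell_q$, floors $\mathcal{F}_1,\dots,\mathcal{F}_q$, and vertical lines $h_1,\dots,h_{q'}$ be as constructed in the context. For $1 \leq i \leq q$ and $1 \leq j \leq q'$ let $$S_k^{i,j} = \{x \in X_{\leq k} : \exists A \in \mathcal{F}_i \text{ such that } x \text{ is } (A,h_j)\text{ -contributed and } x \text{ is an inner contribution of } A\}.$$ Then $|S_k^{i,j}| \leq \frac{(k+1)(k+2)}{2}$ for all such $i,j$.
   Context: General position: no two rectangles of $\mathcal{R}$ have more than 4 common boundary points (no shared boundary segments). Depth of a point: number of rectangles of $\mathcal{R}$ containing it in their interior. A vertex is an intersection point of boundaries of two rectangles. A vertex $x$ is of type L if there are rectangles $A, B \in \mathcal{R}$ such that $x$ lies on the upper edge of $A$ and on the right edge of $B$ and $x$ is the upper-right corner (point with maximal $x$- and $y$-coordinates) of $A \cap B$; write $A_x = A$, $B_x = B$. $X_{\leq k}$ is the set of type-L vertices of depth at most $k$. Horizontal lines: let $R_1$ be a rectangle of $\mathcal{R}$ whose upper edge is lowest, and $\ell_1$ the horizontal line containing it; inductively, as long as some rectangle has lower edge strictly above $\ell_{i-1}$, let $R_i$ be one whose upper edge is lowest among those, and $\ell_i$ the horizontal line containing its upper edge. This yields $\ell_1,\dots,\ell_q$ (the $R_i$ are pairwise disjoint). Let $\ell_{q+1}$ be a horizontal line above all rectangles. Floor $\mathcal{F}_i$ ($1\le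 i\le q$) is the set of rectangles whose upper edge lies on or above $\ell_i$ and strictly below $\ell_{i+1}$. Vertical lines: analogously, let $h_1$ be the vertical line containing the leftmost right edge of a rectangle of $\mathcal{R}$; inductively, as long as some rectangle has left edge strictly to the right of $h_{j-1}$, let $h_j$ be the vertical line containing the leftmost right edge among those rectangles. This yields $h_1,\dots,h_{q'}$ ordered left to right, and every rectangle of $\mathcal{R}$ meets some $h_j$. For $x \in X_{\leq k}$, let $h_x$ be the rightmost line among $\{h_j : h_j \cap B_x \neq \emptyset\}$; $x$ is called $(A_x,h_x)$-contributed. An $(A,h)$-contributed point $x$ is an inner contribution of $A$ if there are points $y,z$ and lines $h',h'' \in \{h_1,\dots,h_{q'}\}$, both different from $h$, such that $y$ is $(A,h')$-contributed, $z$ is $(A,h'')$-contributed, and $x$ lies strictly between $y$ and $z$ on the upper edge of $A$.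
   Formalization: Stated over the rational plane ℚ²: the rectangles of $\mathcal{R}$ have rational coordinates, and the points in $S_k^{i,j}$ and those checked for general position are rational. -}

module Defs where

open import Data.Nat as ℕ using (ℕ; zero; suc)
open import Data.Fin using (Fin)
open import Data.Fin.Subset using (Subset; _∈_; ∣_∣)
open import Data.Rational using (ℚ; _<_; _≤_)
open import Data.Product using (_×_; _,_; Σ; ∃; ∃-syntax; proj₁; proj₂)
open import Data.Sum using (_⊎_)
open import Data.Unit using (⊤)
open import Data.Empty using (⊥)
open import Data.List using (List; length)
open import Data.List.Relation.Unary.All using (All)
open import Data.List.Relation.Unary.Unique.Propositional using (Unique)
open import Relation.Nullary using (¬_)
open import Relation.Binary.PropositionalEquality using (_≡_; _≢_)
open import Function.Bundles using (_⇔_)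

Point : Set
Point = ℚ × ℚ

px py : Point → ℚ
px = proj₁
py = proj₂

record Rect : Set where
  field
    left right bottom top : ℚ
    left<right : left < right
    bottom<top : bottom < top
open Rect public

_∈R_ : Point → Rect → Set
p ∈R r = (left r ≤ px p × px p ≤ right r) × (bottom r ≤ py p × py p ≤ top r)

_∈Int_ : Point → Rect → Set
p ∈Int r = (left r < px p × px p < right r) × (bottom r < py p × py p < top r)

OnBoundary : Rect → Point → Set
OnBoundary r p = p ∈R r × (¬ (p ∈Int r))

OnUpperEdge : Rect → Point → Set
OnUpperEdge r p = py p ≡ top r × (left r ≤ px p × px p ≤ right r)

OnRightEdge : Rect → Point → Set
OnRightEdge r p = px p ≡ right r × (bottom r ≤ py p × py p ≤ top r)

IsUpperRightCornerOfMeet : Rect → Rect → Point → Set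
IsUpperRightCornerOfMeet A B p =
  (p ∈R A × p ∈R B) ×
  (∀ (y : Point) → y ∈R A → y ∈R B → px y ≤ px p × py y ≤ py p)

module _ {n : ℕ} (R : Fin n → Rect) where

  GeneralPosition : Set
  GeneralPosition =
    ∀ (a b : Fin n) → a ≢ b →
    ∀ (ps : List Point) → Unique ps →
    All (λ p → OnBoundary (R a) p × OnBoundary (R b) p) ps →
    length ps ℕ.≤ 4

  DepthAtMost : ℕ → Point → Set
  DepthAtMost k p =
    Σ (Subset n) λ S → (∀ i → (i ∈ S) ⇔ (p ∈Int R i)) × ∣ S ∣ ℕ.≤ k

  TypeL : Point → Fin n → Fin n → Set
  TypeL x A B =
    A ≢ B × OnUpperEdge (R A) x × OnRightEdge (R B) x ×
    IsUpperRightCornerOfMeet (R A) (R B) x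

  InX≤ : ℕ → Point → Set
  InX≤ k x = (∃[ A ] ∃[ B ] TypeL x A B) × DepthAtMost k x

  -- Horizontal lines ℓ_0,…,ℓ_{q-1} (0-based; the paper's ℓ_{i+1}),
  -- given by their y-coordinates.

  HElig : (ℕ → ℚ) → ℕ → Fin n → Set
  HElig ℓ zero    r = ⊤
  HElig ℓ (suc m) r = ℓ m < bottom (R r)

  IsHorizontalLines : ℕ → (ℕ → ℚ) → Set
  IsHorizontalLines q ℓ =
    (∀ i → i ℕ.< q →
       ∃[ r ] (HElig ℓ i r × top (R r) ≡ ℓ i ×
               (∀ r' → HElig ℓ i r' → ℓ i ≤ top (R r')))) ×
    (∀ r → ¬ HElig ℓ q r)

  -- Floor i (0-based, i < q): upper edge on or above ℓ_i and strictly below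
  -- ℓ_{i+1}; for the last floor the upper bound is the line above all
  -- rectangles, i.e. no constraint.
  InFloor : ℕ → (ℕ → ℚ) → ℕ → Fin n → Set
  InFloor q ℓ i A = ℓ i ≤ top (R A) × (suc i ℕ.< q → top (R A) < ℓ (suc i))

  -- Vertical lines h_0,…,h_{q'-1} (0-based), given by their x-coordinates.

  VElig : (ℕ → ℚ) → ℕ → Fin n → Set
  VElig h zero    r = ⊤
  VElig h (suc m) r = h m < left (R r)

  IsVerticalLines : ℕ → (ℕ → ℚ) → Set
  IsVerticalLines q' h =
    (∀ j → j ℕ.< q' →
       ∃[ r ] (VElig h j r × right (R r) ≡ h j ×
               (∀ r' → VElig h j r' → h j ≤ right (R r')))) ×
    (∀ r → ¬ VElig h q' r)

  MeetsV : ℚ → Fin n → Set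
  MeetsV c B = left (R B) ≤ c × c ≤ right (R B)

  IsRightmostMeeting : ℕ → (ℕ → ℚ) → Fin n → ℕ → Set
  IsRightmostMeeting q' h B j =
    j ℕ.< q' × MeetsV (h j) B ×
    (∀ j' → j' ℕ.< q' → MeetsV (h j') B → h j' ≤ h j)

  Contributed : ℕ → ℕ → (ℕ → ℚ) → Fin n → ℕ → Point → Set
  Contributed k q' h A j x =
    ∃[ B ] (TypeL x A B × DepthAtMost k x × IsRightmostMeeting q' h B j)

  InnerContribution : ℕ → ℕ → (ℕ → ℚ) → Fin n → ℕ → Point → Set
  InnerContribution k q' h A j x =
    ∃[ y ] ∃[ z ] ∃[ j' ] ∃[ j'' ]
      (j' ≢ j × j'' ≢ j ×
       Contributed k q' h A j' y × Contributed k q' h A j'' z ×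
       OnUpperEdge (R A) y × OnUpperEdge (R A) x × OnUpperEdge (R A) z ×
       ((px y < px x × px x < px z) ⊎ (px z < px x × px x < px y)))

  InS : ℕ → ℕ → (ℕ → ℚ) → ℕ → (ℕ → ℚ) → ℕ → ℕ → Point → Set
  InS k q ℓ q' h i j x =
    InX≤ k x ×
    ∃[ A ] (InFloor q ℓ i A × Contributed k q' h A j x ×
            InnerContribution k q' h A j x)

-- Fix i and j and write c = h_j, d = h_{j+1}.  A point x of S_k^{i,j} with witnesses
-- A = A_x and B = B_x is the corner (right B, top A).  Since x is an inner contribution,
-- A reaches from the left of c to the right of d, while B meets h_j but not h_{j+1};
-- since A lies in floor i, its bottom is at most ℓ_i, hence at most the top of every
-- other such A.  With general position this puts x in the interior of A_y for every
-- point y of S above x, and in the interior of B_y for every y of S in the same row to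
-- its right; moreover A_y determines the row of y, B_y its column, and no A_y is a B_z.
-- So the top row of S has at most k + 1 points (the B of its rightmost point covers the
-- others), and all lower points lie in the A of the top row, so they have depth at most
-- k - 1 in the remaining rectangles.  Hence |S| ≤ (k + 1) + k + ... + 1.

module Submission where

open import Defs
open import Data.Nat using (ℕ; zero; suc; z≤n; s≤s; _+_; _*_; _≤_; _<_)
import Data.Nat.Properties as ℕP
open import Data.Nat.Tactic.RingSolver using (solve-∀)
open import Data.Rational as ℚ using (ℚ; _⊔_)
import Data.Rational.Properties as ℚP
open import Data.Product using (_×_; _,_; proj₁; proj₂; ∃-syntax; Σ-syntax)
open import Data.Sum using (_⊎_; inj₁; inj₂; [_,_]′)
open import Data.Empty using (⊥; ⊥-elim)
open import Data.Fin using (Fin)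
open import Data.Fin.Subset as Subset using (Subset; ∣_∣; _-_)
open import Data.Fin.Subset.Properties
  using (x∈p⇒∣p-x∣<∣p∣; x∈p∧x∉q⇒x∈p─q; x≢y⇒x∉⁅y⁆)
open import Data.List using (List; []; _∷_; length; filter; map)
open import Data.List.Properties using (length-map)
import Data.List.Relation.Unary.All.Properties as All
import Data.List.Relation.Unary.Unique.Propositional.Properties as Unique
open import Data.List.Relation.Unary.All as All using (All; []; _∷_)
open import Data.List.Relation.Unary.Any using (here; there)
open import Data.List.Relation.Unary.AllPairs using (AllPairs; []; _∷_)
import Data.List.Relation.Unary.AllPairs.Properties as AllPairs
open import Data.List.Relation.Unary.Unique.Propositional using (Unique)
open import Data.List.Membership.Propositional using (_∈_)
open import Data.List.Membership.Propositional.Properties using (∈-filter⁻)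
open import Relation.Binary using (DecTotalOrder)
open import Relation.Binary.PropositionalEquality
  using (_≡_; _≢_; refl; sym; trans; cong; cong₂; subst; subst₂; ≢-sym)
open import Relation.Nullary using (¬_; yes; no)
open import Relation.Unary using (Decidable)
open import Relation.Unary.Properties using (∁?)
open import Function using (_on_; _∘_; _$_)
open import Function.Bundles using (Equivalence)

open import Data.List.Extrema (DecTotalOrder.totalOrder ℚP.≤-decTotalOrder)
  using (argmax; argmax-sel; f[⊥]≤f[argmax]; f[xs]≤f[argmax])

module _ {A : Set} {P : A → Set} (P? : Decidable P) where

  length-filter+filter-∁ : ∀ xs →
    length (filter P? xs) + length (filter (∁? P?) xs) ≡ length xs
  length-filter+filter-∁ [] = refl
  length-filter+filter-∁ (x ∷ xs) with P? x
  ... | yes _ = cong suc (length-filter+filter-∁ xs)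
  ... | no _  = trans (ℕP.+-suc _ _) (cong suc (length-filter+filter-∁ xs))

Unique∧All∈⇒length≤∣p∣ : ∀ {n} {p : Subset n} {rs : List (Fin n)} →
  Unique rs → All (Subset._∈ p) rs → length rs ≤ ∣ p ∣
Unique∧All∈⇒length≤∣p∣ [] [] = z≤n
Unique∧All∈⇒length≤∣p∣ {p = p} {r ∷ _} (r∉rs ∷ rs!) (r∈p ∷ rs∈p) =
  ℕP.≤-trans
  (s≤s (Unique∧All∈⇒length≤∣p∣ rs! (All.zipWith ∈p-r (r∉rs , rs∈p))))
  (x∈p⇒∣p-x∣<∣p∣ r∈p)
  where
  ∈p-r : ∀ {r′} → r ≢ r′ × r′ Subset.∈ p → r′ Subset.∈ p - r
  ∈p-r (r≢r′ , r′∈p) = x∈p∧x∉q⇒x∈p─q r′∈p (x≢y⇒x∉⁅y⁆ (≢-sym r≢r′))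

AllPairs-≢-const⇒length≤1 : ∀ {A B : Set} {f : A → B} {c : B} {xs : List A} →
  AllPairs (_≢_ on f) xs → All (λ x → f x ≡ c) xs → length xs ≤ 1
AllPairs-≢-const⇒length≤1 []              _                 = z≤n
AllPairs-≢-const⇒length≤1 (_ ∷ [])        _                 = s≤s z≤n
AllPairs-≢-const⇒length≤1 ((x≢y ∷ _) ∷ _) (fx≡c ∷ fy≡c ∷ _) =
  ⊥-elim (x≢y (trans fx≡c (sym fy≡c)))

≤∧≢⇒< : ∀ {p q : ℚ} → p ℚ.≤ q → p ≢ q → p ℚ.< q
≤∧≢⇒< p≤q p≢q = ℚP.≰⇒> λ q≤p → p≢q (ℚP.≤-antisym p≤q q≤p)

⊔-lub-< : ∀ {p q r} → p ℚ.< r → q ℚ.< r → p ⊔ q ℚ.< r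
⊔-lub-< {p} {q} {r} p<r q<r with ℚP.⊔-sel p q
... | inj₁ p⊔q≡p = subst (ℚ._< r) (sym p⊔q≡p) p<r
... | inj₂ p⊔q≡q = subst (ℚ._< r) (sym p⊔q≡q) q<r

unique-points-between : ∀ m {u v : ℚ} → u ℚ.< v →
  ∃[ ts ] length ts ≡ m × Unique ts × All (λ t → u ℚ.< t × t ℚ.≤ v) ts
unique-points-between zero    _   = [] , refl , [] , []
unique-points-between (suc m) u<v with ℚP.<-dense u<v
... | w , u<w , w<v with unique-points-between m u<w
... | ts , refl , ts! , ts∈ =
  _ ∷ ts , refl ,
  All.map (λ (_ , t≤w) → ℚP.<⇒≢ (ℚP.≤-<-trans t≤w w<v) ∘ sym) ts∈ ∷ ts! ,
  (u<v , ℚP.≤-refl) ∷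
    All.map (λ (u<t , t≤w) → u<t , ℚP.<⇒≤ (ℚP.≤-<-trans t≤w w<v)) ts∈

module SplitAtArgmax {A : Set} (f : A → ℚ) (x : A) (xs : List A) where

  max : A
  max = argmax f x xs

  max∈ : max ∈ x ∷ xs
  max∈ = [ here , there ]′ (argmax-sel f x xs)

  ≤-max : All (λ y → f y ℚ.≤ f max) (x ∷ xs)
  ≤-max = f[⊥]≤f[argmax] {f = f} x xs ∷ f[xs]≤f[argmax] {f = f} x xs

  atMax? : Decidable (λ y → f max ℚ.≤ f y)
  atMax? y = f max ℚP.≤? f y

  onTop below : List A
  onTop = filter atMax? (x ∷ xs)
  below = filter (∁? atMax?) (x ∷ xs)

  length-onTop+below : length onTop + length below ≡ length (x ∷ xs)
  length-onTop+below = length-filter+filter-∁ atMax? (x ∷ xs)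

  ∈-onTop⁻ : ∀ {y} → y ∈ onTop → y ∈ x ∷ xs × f y ≡ f max
  ∈-onTop⁻ y∈ with ∈-filter⁻ atMax? y∈
  ... | y∈xs , max≤y = y∈xs , ℚP.≤-antisym (All.lookup ≤-max y∈xs) max≤y

  ∈-below⁻ : ∀ {y} → y ∈ below → y ∈ x ∷ xs × f y ℚ.< f max
  ∈-below⁻ y∈ with ∈-filter⁻ (∁? atMax?) y∈
  ... | y∈xs , max≰y = y∈xs , ℚP.≰⇒> max≰y

DepthBelow : {Item I : Set} → (Item → I → Set) → ℕ → Item → Set
DepthBelow _◃_ k x = ∀ rs → Unique rs → All (x ◃_) rs → length rs < k

_without_ : {Item I : Set} → (Item → I → Set) → I → Item → I → Set
(_◃_ without e) x r = x ◃ r × r ≢ e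

module _ {Item I : Set} (_◃_ : Item → I → Set) {x : Item} where

  ¬DepthBelow-zero : ¬ DepthBelow _◃_ zero x
  ¬DepthBelow-zero depth = ℕP.n≮0 (depth [] [] [])

  DepthBelow-without : ∀ {e k} → x ◃ e → DepthBelow _◃_ (suc k) x →
                       DepthBelow (_◃_ without e) k x
  DepthBelow-without {e} x◃e depth rs rs! x◃rs = ℕP.≤-pred
    (depth (e ∷ rs) (All.map (≢-sym ∘ proj₂) x◃rs ∷ rs!) (x◃e ∷ All.map proj₁ x◃rs))

DepthAtMost⇒DepthBelow : ∀ {n} (R : Fin n → Rect) {k p} →
  DepthAtMost R k p → DepthBelow (λ p r → p ∈Int R r) (suc k) p
DepthAtMost⇒DepthBelow R (S , S↔inside , ∣S∣≤k) rs rs! inside =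
  s≤s (ℕP.≤-trans (Unique∧All∈⇒length≤∣p∣ rs! (All.map (λ {r} → from (S↔inside r)) inside)) ∣S∣≤k)
  where open Equivalence

triangle-step : ∀ k → 2 * suc k + k * suc k ≡ suc k * suc (suc k)
triangle-step = solve-∀

-- The counting argument, abstracted: items are points labelled by two "rectangles" A and B,
-- and x ◃ r stands for "x lies in the interior of r".
module Staircase {Item I : Set} (pt : Item → Point) (A B : Item → I)
  (A-height   : ∀ {x y} → A x ≡ A y → py (pt x) ≡ py (pt y))
  (B-abscissa : ∀ {x y} → B x ≡ B y → px (pt x) ≡ px (pt y))
  (A≢B        : ∀ x y → A x ≢ B y)
  where

  height abscissa : Item → ℚ
  height   = py ∘ pt
  abscissa = px ∘ pt

  CoveredFromAbove : (Item → I → Set) → List Item → Set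
  CoveredFromAbove _◃_ S = ∀ {x y} → x ∈ S → y ∈ S →
    height x ℚ.< height y → x ◃ A y

  CoveredFromRight : (Item → I → Set) → List Item → Set
  CoveredFromRight _◃_ S = ∀ {x y} → x ∈ S → y ∈ S →
    height x ≡ height y → abscissa x ℚ.< abscissa y → x ◃ B y

  Shallow : (Item → I → Set) → ℕ → List Item → Set
  Shallow _◃_ k S = ∀ {x} → x ∈ S → DepthBelow _◃_ k x

  row-length≤ : ∀ k _◃_ T → AllPairs (_≢_ on pt) T →
    (∀ {x y} → x ∈ T → y ∈ T → height x ≡ height y) →
    CoveredFromRight _◃_ T → Shallow _◃_ k T → length T ≤ k
  row-length≤ _       _   []         _        _     _       _       = z≤n
  row-length≤ zero    _◃_ (_ ∷ _)    _        _     _       shallow =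
    ⊥-elim (¬DepthBelow-zero _◃_ (shallow (here refl)))
  row-length≤ (suc k) _◃_ T@(t ∷ ts) distinct level coveredB shallow = begin
    length T                     ≡⟨ sym length-onTop+below ⟩
    length onTop + length below  ≤⟨ ℕP.+-mono-≤ onTop≤1 below≤k ⟩
    1 + k                        ∎
    where
    open ℕP.≤-Reasoning
    open SplitAtArgmax abscissa t ts

    onTop≤1 : length onTop ≤ 1
    onTop≤1 = AllPairs-≢-const⇒length≤1 (AllPairs.filter⁺ atMax? distinct)
      (All.tabulate λ x∈ → let x∈T , x≡max = ∈-onTop⁻ x∈ in
        cong₂ _,_ x≡max (level x∈T max∈))

    below≤k : length below ≤ k
    below≤k = row-length≤ k (_◃_ without B max) below
      (AllPairs.filter⁺ (∁? atMax?) distinct)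
      (λ x∈ y∈ → level (proj₁ (∈-below⁻ x∈)) (proj₁ (∈-below⁻ y∈)))
      (λ x∈ y∈ x~y x<y → let y∈T , y<max = ∈-below⁻ y∈ in
        coveredB (proj₁ (∈-below⁻ x∈)) y∈T x~y x<y , ℚP.<⇒≢ y<max ∘ B-abscissa)
      (λ x∈ → let x∈T , x<max = ∈-below⁻ x∈ in
        DepthBelow-without _◃_ (coveredB x∈T max∈ (level x∈T max∈) x<max) (shallow x∈T))

  staircase-length≤ : ∀ k _◃_ S → AllPairs (_≢_ on pt) S →
    CoveredFromAbove _◃_ S → CoveredFromRight _◃_ S → Shallow _◃_ k S →
    2 * length S ≤ k * suc k
  staircase-length≤ _       _   []         _        _     _     _       = z≤n
  staircase-length≤ zero    _◃_ (_ ∷ _)    _        _     _     shallow =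
    ⊥-elim (¬DepthBelow-zero _◃_ (shallow (here refl)))
  staircase-length≤ (suc k) _◃_ S@(t ∷ ts) distinct coveredA coveredB shallow = begin
    2 * length S                          ≡⟨ cong (2 *_) (sym length-onTop+below) ⟩
    2 * (length onTop + length below)     ≡⟨ ℕP.*-distribˡ-+ 2 (length onTop) (length below) ⟩
    2 * length onTop + 2 * length below   ≤⟨ ℕP.+-mono-≤ (ℕP.*-monoʳ-≤ 2 onTop≤) below≤ ⟩
    2 * suc k + k * suc k                 ≡⟨ triangle-step k ⟩
    suc k * suc (suc k)                   ∎
    where
    open ℕP.≤-Reasoning
    open SplitAtArgmax height t ts

    onTop≤ : length onTop ≤ suc k
    onTop≤ = row-length≤ (suc k) _◃_ onTop (AllPairs.filter⁺ atMax? distinct)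
      (λ x∈ y∈ → trans (proj₂ (∈-onTop⁻ x∈)) (sym (proj₂ (∈-onTop⁻ y∈))))
      (λ x∈ y∈ → coveredB (proj₁ (∈-onTop⁻ x∈)) (proj₁ (∈-onTop⁻ y∈)))
      (shallow ∘ proj₁ ∘ ∈-onTop⁻)

    below≤ : 2 * length below ≤ k * suc k
    below≤ = staircase-length≤ k (_◃_ without A max) below
      (AllPairs.filter⁺ (∁? atMax?) distinct)
      (λ x∈ y∈ x<y → let y∈S , y<max = ∈-below⁻ y∈ in
        coveredA (proj₁ (∈-below⁻ x∈)) y∈S x<y , ℚP.<⇒≢ y<max ∘ A-height)
      (λ x∈ y∈ x~y x<y → let y∈S , _ = ∈-below⁻ y∈ in
        coveredB (proj₁ (∈-below⁻ x∈)) y∈S x~y x<y , A≢B max _ ∘ sym)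
      (λ x∈ → let x∈S , x<max = ∈-below⁻ x∈ in
        DepthBelow-without _◃_ (coveredA x∈S max∈ x<max) (shallow x∈S))

HorizontalEdgeAt : Rect → ℚ → Set
HorizontalEdgeAt r y = y ≡ bottom r ⊎ y ≡ top r

VerticalEdgeAt : Rect → ℚ → Set
VerticalEdgeAt r x = x ≡ left r ⊎ x ≡ right r

horizontal-edge⇒boundary : ∀ r {y t} → HorizontalEdgeAt r y →
  left r ℚ.≤ t → t ℚ.≤ right r → OnBoundary r (t , y)
horizontal-edge⇒boundary r (inj₁ refl) l≤t t≤r =
  ((l≤t , t≤r) , ℚP.≤-refl , ℚP.<⇒≤ (bottom<top r)) , λ (_ , b<b , _) → ℚP.<-irrefl refl b<b
horizontal-edge⇒boundary r (inj₂ refl) l≤t t≤r =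
  ((l≤t , t≤r) , ℚP.<⇒≤ (bottom<top r) , ℚP.≤-refl) , λ (_ , _ , T<T) → ℚP.<-irrefl refl T<T

vertical-edge⇒boundary : ∀ r {x t} → VerticalEdgeAt r x →
  bottom r ℚ.≤ t → t ℚ.≤ top r → OnBoundary r (x , t)
vertical-edge⇒boundary r (inj₁ refl) b≤t t≤T =
  ((ℚP.≤-refl , ℚP.<⇒≤ (left<right r)) , b≤t , t≤T) , λ ((l<l , _) , _) → ℚP.<-irrefl refl l<l
vertical-edge⇒boundary r (inj₂ refl) b≤t t≤T =
  ((ℚP.<⇒≤ (left<right r) , ℚP.≤-refl) , b≤t , t≤T) , λ ((_ , r<r) , _) → ℚP.<-irrefl refl r<r

module GeneralPositionEdges {n} (R : Fin n → Rect) (general : GeneralPosition R) where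

  no-common-boundary-segment : ∀ {a b} → a ≢ b →
    (f : ℚ → Point) → (∀ {s t} → f s ≡ f t → s ≡ t) →
    ∀ {u v} → u ℚ.< v →
    (∀ {t} → u ℚ.≤ t → t ℚ.≤ v → OnBoundary (R a) (f t) × OnBoundary (R b) (f t)) → ⊥
  no-common-boundary-segment a≢b f f-injective u<v on-both =
    let ts , |ts|≡5 , ts! , ts∈ = unique-points-between 5 u<v in
    ℕP.<⇒≱ (ℕP.n<1+n 4) (subst (_≤ 4) (trans (length-map f ts) |ts|≡5)
      (general _ _ a≢b (map f ts) (Unique.map⁺ f-injective ts!)
        (All.map⁺ (All.map (λ (u<t , t≤v) → on-both (ℚP.<⇒≤ u<t) t≤v) ts∈))))

  horizontal-edges-apart : ∀ {a b y v} → a ≢ b →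
    HorizontalEdgeAt (R a) y → HorizontalEdgeAt (R b) y →
    left (R a) ⊔ left (R b) ℚ.< v → v ℚ.≤ right (R a) → v ℚ.≤ right (R b) → ⊥
  horizontal-edges-apart {a} {b} {y} a≢b a-edge b-edge lub<v v≤ra v≤rb =
    no-common-boundary-segment a≢b (λ t → t , y) (cong proj₁) lub<v λ lub≤t t≤v →
      horizontal-edge⇒boundary (R a) a-edge
        (ℚP.p⊔q≤r⇒p≤r _ _ lub≤t) (ℚP.≤-trans t≤v v≤ra) ,
      horizontal-edge⇒boundary (R b) b-edge
        (ℚP.p⊔q≤r⇒q≤r (left (R a)) _ lub≤t) (ℚP.≤-trans t≤v v≤rb)

  vertical-edges-apart : ∀ {a b x v} → a ≢ b →
    VerticalEdgeAt (R a) x → VerticalEdgeAt (R b) x →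
    bottom (R a) ⊔ bottom (R b) ℚ.< v → v ℚ.≤ top (R a) → v ℚ.≤ top (R b) → ⊥
  vertical-edges-apart {a} {b} {x} a≢b a-edge b-edge lub<v v≤ta v≤tb =
    no-common-boundary-segment a≢b (λ t → x , t) (cong proj₂) lub<v λ lub≤t t≤v →
      vertical-edge⇒boundary (R a) a-edge
        (ℚP.p⊔q≤r⇒p≤r _ _ lub≤t) (ℚP.≤-trans t≤v v≤ta) ,
      vertical-edge⇒boundary (R b) b-edge
        (ℚP.p⊔q≤r⇒q≤r (bottom (R a)) _ lub≤t) (ℚP.≤-trans t≤v v≤tb)

  right-edge-crosses-upper-edge : ∀ {a b} → a ≢ b →
    left (R a) ℚ.< right (R b) → right (R b) ℚ.≤ right (R a) →
    bottom (R b) ℚ.≤ top (R a) → top (R a) ℚ.≤ top (R b) →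
    bottom (R b) ℚ.< top (R a) × top (R a) ℚ.< top (R b)
  right-edge-crosses-upper-edge {a} {b} a≢b la<rb rb≤ra bb≤ta ta≤tb =
    ≤∧≢⇒< bb≤ta (λ bb≡ta → apart (inj₁ (sym bb≡ta))) ,
    ≤∧≢⇒< ta≤tb (λ ta≡tb → apart (inj₂ ta≡tb))
    where
    apart : HorizontalEdgeAt (R b) (top (R a)) → ⊥
    apart b-edge = horizontal-edges-apart a≢b (inj₂ refl) b-edge
      (⊔-lub-< la<rb (left<right (R b))) rb≤ra ℚP.≤-refl

module VerticalLines {n} (R : Fin n → Rect) {q′ : ℕ} {h : ℕ → ℚ}
  (lines : IsVerticalLines R q′ h) where

  h-step : ∀ {m} → suc m < q′ → h m ℚ.< h (suc m)
  h-step {m} sm<q′ with proj₁ lines (suc m) sm<q′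
  ... | r , hm<left , right≡h , _ =
    ℚP.<-≤-trans (ℚP.<-trans hm<left (left<right (R r))) (ℚP.≤-reflexive right≡h)

  h-< : ∀ {a b} → a < b → b < q′ → h a ℚ.< h b
  h-< {a} {suc b} (s≤s a≤b) sb<q′ with ℕP.m≤n⇒m<n∨m≡n a≤b
  ... | inj₁ a<b  = ℚP.<-trans (h-< a<b (ℕP.<-trans (ℕP.n<1+n b) sb<q′)) (h-step sb<q′)
  ... | inj₂ refl = h-step sb<q′

  h-≤ : ∀ {a b} → a ≤ b → b < q′ → h a ℚ.≤ h b
  h-≤ a≤b b<q′ with ℕP.m≤n⇒m<n∨m≡n a≤b
  ... | inj₁ a<b  = ℚP.<⇒≤ (h-< a<b b<q′)
  ... | inj₂ refl = ℚP.≤-refl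

  Rightmost : Fin n → ℕ → Set
  Rightmost = IsRightmostMeeting R q′ h

  right<h-beyond-rightmost : ∀ {B j j′} → Rightmost B j → j < j′ → j′ < q′ →
    right (R B) ℚ.< h j′
  right<h-beyond-rightmost (_ , (left≤hj , _) , rightmost) j<j′ j′<q′ =
    ℚP.≰⇒> λ hj′≤right → ℚP.<-irrefl refl (ℚP.<-≤-trans hj<hj′
      (rightmost _ j′<q′ (ℚP.≤-trans left≤hj (ℚP.<⇒≤ hj<hj′) , hj′≤right)))
    where hj<hj′ = h-< j<j′ j′<q′

  rightmost-mono : ∀ {B B′ j j′} → Rightmost B j → Rightmost B′ j′ →
    right (R B) ℚ.< right (R B′) → j ≤ j′
  rightmost-mono {B} {B′} {j} (j<q′ , (_ , hj≤rB) , _) B′-rm rB<rB′ = ℕP.≮⇒≥ λ j′<j →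
    ℚP.<-irrefl refl $ begin-strict
      right (R B′) <⟨ right<h-beyond-rightmost B′-rm j′<j j<q′ ⟩
      h j          ≤⟨ hj≤rB ⟩
      right (R B)  <⟨ rB<rB′ ⟩
      right (R B′) ∎
    where open ℚP.≤-Reasoning

floor-bottom≤ℓ : ∀ {n} (R : Fin n → Rect) {q ℓ i A} → IsHorizontalLines R q ℓ → i < q →
  InFloor R q ℓ i A → bottom (R A) ℚ.≤ ℓ i
floor-bottom≤ℓ R {q} {ℓ} {i} {A} (steps , exhausted) i<q (_ , below-next) =
  ℚP.≮⇒≥ λ ℓi<bottom → next-eligible ℓi<bottom (ℕP.m≤n⇒m<n∨m≡n i<q)
  where
  next-eligible : HElig R ℓ (suc i) A → suc i < q ⊎ suc i ≡ q → ⊥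
  next-eligible eligible (inj₁ si<q) with steps (suc i) si<q
  ... | _ , _ , _ , lowest = ℚP.<-irrefl refl (ℚP.≤-<-trans (lowest A eligible) (below-next si<q))
  next-eligible eligible (inj₂ refl) = exhausted A eligible

module InnerContributions {n} (R : Fin n → Rect) (general : GeneralPosition R) (k : ℕ)
  {q : ℕ} {ℓ : ℕ → ℚ} (floors : IsHorizontalLines R q ℓ)
  {q′ : ℕ} {h : ℕ → ℚ} (lines : IsVerticalLines R q′ h)
  {i j : ℕ} (i<q : i < q) (j<q′ : j < q′)
  where

  open GeneralPositionEdges R general
  open VerticalLines R lines

  -- d is junk unless suc j < q′, which every inner contribution guarantees.
  c d : ℚ
  c = h j
  d = h (suc j)

  left-neighbour : ∀ {A B j′} x y → Rightmost B j → px x ≡ right (R B) → j′ ≢ j →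
    Contributed R k q′ h A j′ y → OnUpperEdge (R A) y → px y ℚ.< px x → left (R A) ℚ.< c
  left-neighbour {A} {B} x y B-rm x≡rB j′≢j
    (By , (_ , _ , (y≡rBy , _) , _) , _ , By-rm) (_ , lA≤y , _) y<x =
    begin-strict
      left (R A)   ≤⟨ lA≤y ⟩
      px y         ≡⟨ y≡rBy ⟩
      right (R By) <⟨ right<h-beyond-rightmost By-rm j′<j j<q′ ⟩
      c            ∎
    where
    open ℚP.≤-Reasoning
    j′<j = ℕP.≤∧≢⇒< (rightmost-mono By-rm B-rm (subst₂ ℚ._<_ y≡rBy x≡rB y<x)) j′≢j

  right-neighbour : ∀ {A B j″} x z → Rightmost B j → px x ≡ right (R B) → j″ ≢ j →
    Contributed R k q′ h A j″ z → OnUpperEdge (R A) z → px x ℚ.< px z →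
    suc j < q′ × d ℚ.≤ right (R A)
  right-neighbour {A} {B} {j″} x z B-rm x≡rB j″≢j
    (Bz , (_ , _ , (z≡rBz , _) , _) , _ , Bz-rm@(j″<q′ , (_ , hj″≤rBz) , _)) (_ , _ , z≤rA) x<z =
    ℕP.≤-<-trans j<j″ j″<q′ ,
    (begin
      d            ≤⟨ h-≤ j<j″ j″<q′ ⟩
      h j″         ≤⟨ hj″≤rBz ⟩
      right (R Bz) ≡⟨ sym z≡rBz ⟩
      px z         ≤⟨ z≤rA ⟩
      right (R A)  ∎)
    where
    open ℚP.≤-Reasoning
    j<j″ = ℕP.≤∧≢⇒< (rightmost-mono B-rm Bz-rm (subst₂ ℚ._<_ x≡rB z≡rBz x<z)) (≢-sym j″≢j)

  inner-contribution-spans : ∀ {A B x} → Rightmost B j → px x ≡ right (R B) →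
    InnerContribution R k q′ h A j x →
    left (R A) ℚ.< c × suc j < q′ × d ℚ.≤ right (R A)
  inner-contribution-spans {x = x} B-rm x≡rB
    (y , z , j′ , j″ , j′≢j , j″≢j , y-con , z-con , y-up , _ , z-up , y<x<z⊎z<x<y)
    with y<x<z⊎z<x<y
  ... | inj₁ (y<x , x<z) = left-neighbour  x y B-rm x≡rB j′≢j y-con y-up y<x
                         , right-neighbour x z B-rm x≡rB j″≢j z-con z-up x<z
  ... | inj₂ (z<x , x<y) = left-neighbour  x z B-rm x≡rB j″≢j z-con z-up z<x
                         , right-neighbour x y B-rm x≡rB j′≢j y-con y-up x<y

  record PointOfS : Set where
    field
      A B            : Fin n
      depth≤k        : DepthAtMost R k (right (R B) , top (R A))
      A-left<c       : left (R A) ℚ.< c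
      d≤A-right      : d ℚ.≤ right (R A)
      B-meets-c      : MeetsV R c B
      B-right<d      : right (R B) ℚ.< d
      A-bottom≤ℓ     : bottom (R A) ℚ.≤ ℓ i
      ℓ≤A-top        : ℓ i ℚ.≤ top (R A)
      B-bottom<A-top : bottom (R B) ℚ.< top (R A)
      A-top<B-top    : top (R A) ℚ.< top (R B)

    pt : Point
    pt = right (R B) , top (R A)

  open PointOfS

  toPointOfS : ∀ {x} → InS R k q ℓ q′ h i j x → Σ[ s ∈ PointOfS ] pt s ≡ x
  toPointOfS (_ , A , in-floor ,
              (B , (A≢B , (refl , _ , rB≤rA) , (refl , bB≤tA , tA≤tB) , _) , depth , B-rm) , inner)
    with inner-contribution-spans B-rm refl inner
  ... | lA<c , sj<q′ , d≤rA = record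
    { A = A ; B = B ; depth≤k = depth
    ; A-left<c = lA<c ; d≤A-right = d≤rA
    ; B-meets-c = proj₁ (proj₂ B-rm)
    ; B-right<d = right<h-beyond-rightmost B-rm (ℕP.n<1+n j) sj<q′
    ; A-bottom≤ℓ = floor-bottom≤ℓ R floors i<q in-floor ; ℓ≤A-top = proj₁ in-floor
    ; B-bottom<A-top = proj₁ crossing ; A-top<B-top = proj₂ crossing
    } , refl
    where
    crossing = right-edge-crosses-upper-edge A≢B
      (ℚP.<-≤-trans lA<c (proj₂ (proj₁ (proj₂ B-rm)))) rB≤rA bB≤tA tA≤tB

  toPointsOfS : ∀ {xs} → All (InS R k q ℓ q′ h i j) xs →
    Σ[ ss ∈ List PointOfS ] map pt ss ≡ xs
  toPointsOfS [] = [] , refl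
  toPointsOfS (x∈S ∷ xs⊆S) with toPointOfS x∈S | toPointsOfS xs⊆S
  ... | s , refl | ss , refl = s ∷ ss , refl

  c≤A-right : ∀ s → c ℚ.≤ right (R (A s))
  c≤A-right s = ℚP.≤-trans (proj₂ (B-meets-c s)) (ℚP.<⇒≤ (ℚP.<-≤-trans (B-right<d s) (d≤A-right s)))

  A≢B : ∀ s t → A s ≢ B t
  A≢B s t As≡Bt =
    ℚP.<-irrefl (cong (right ∘ R) (sym As≡Bt)) (ℚP.<-≤-trans (B-right<d t) (d≤A-right s))

  below⇒∈Int-A : ∀ s t → py (pt s) ℚ.< py (pt t) → pt s ∈Int R (A t)
  below⇒∈Int-A s t tAs<tAt = (lAt<rBs , rBs<rAt) , bAt<tAs , tAs<tAt
    where
    lAt<rBs = ℚP.<-≤-trans (A-left<c t) (proj₂ (B-meets-c s))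
    rBs<rAt = ℚP.<-≤-trans (B-right<d s) (d≤A-right t)
    bAt<tAs = ≤∧≢⇒< (ℚP.≤-trans (A-bottom≤ℓ t) (ℓ≤A-top s)) λ bAt≡tAs →
      horizontal-edges-apart (λ As≡At → ℚP.<-irrefl (cong (top ∘ R) As≡At) tAs<tAt)
        (inj₂ refl) (inj₁ (sym bAt≡tAs))
        (⊔-lub-< (A-left<c s) (A-left<c t)) (c≤A-right s) (c≤A-right t)

  leftOf⇒∈Int-B : ∀ s t → py (pt s) ≡ py (pt t) → px (pt s) ℚ.< px (pt t) → pt s ∈Int R (B t)
  leftOf⇒∈Int-B s t tAs≡tAt rBs<rBt = (lBt<rBs , rBs<rBt) , bBt<tAs , tAs<tBt
    where
    bBt<tAs = subst (bottom (R (B t)) ℚ.<_) (sym tAs≡tAt) (B-bottom<A-top t)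
    tAs<tBt = subst (ℚ._< top (R (B t))) (sym tAs≡tAt) (A-top<B-top t)
    lBt<rBs = ≤∧≢⇒< (ℚP.≤-trans (proj₁ (B-meets-c t)) (proj₂ (B-meets-c s))) λ lBt≡rBs →
      vertical-edges-apart (λ Bs≡Bt → ℚP.<-irrefl (cong (right ∘ R) Bs≡Bt) rBs<rBt)
        (inj₂ refl) (inj₁ (sym lBt≡rBs))
        (⊔-lub-< (B-bottom<A-top s) bBt<tAs) (ℚP.<⇒≤ (A-top<B-top s)) (ℚP.<⇒≤ tAs<tBt)

  open Staircase pt A B (cong (top ∘ R)) (cong (right ∘ R)) A≢B

  2*|S|≤ : ∀ {xs} → Unique xs → All (InS R k q ℓ q′ h i j) xs →
    2 * length xs ≤ suc k * suc (suc k)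
  2*|S|≤ xs! xs⊆S with toPointsOfS xs⊆S
  ... | ss , refl = begin
    2 * length (map pt ss)  ≡⟨ cong (2 *_) (length-map pt ss) ⟩
    2 * length ss           ≤⟨ staircase-length≤ (suc k) (λ s r → pt s ∈Int R r) ss
                                 (AllPairs.map⁻ xs!)
                                 (λ {s} {t} _ _ → below⇒∈Int-A s t)
                                 (λ {s} {t} _ _ → leftOf⇒∈Int-B s t)
                                 (λ {s} _ → DepthAtMost⇒DepthBelow R (depth≤k s)) ⟩
    suc k * suc (suc k)     ∎
    where open ℕP.≤-Reasoning

proposition1 : (n : ℕ) (R : Fin n → Rect) → GeneralPosition R →
    (k : ℕ) →
    (q : ℕ) (ℓ : ℕ → ℚ) → IsHorizontalLines R q ℓ →
    (q' : ℕ) (h : ℕ → ℚ) → IsVerticalLines R q' h →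
    (i j : ℕ) → i < q → j < q' →
    (xs : List Point) → Unique xs → All (InS R k q ℓ q' h i j) xs →
    2 * length xs ≤ (k + 1) * (k + 2)
proposition1 _ R general k _ _ floors _ _ lines _ _ i<q j<q′ xs xs! xs⊆S =
  subst (2 * length xs ≤_) (cong₂ _*_ (ℕP.+-comm 1 k) (ℕP.+-comm 2 k))
    (InnerContributions.2*|S|≤ R general k floors lines i<q j<q′ xs! xs⊆S)
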